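{- Let $(R,\mathfrak{m})$ be a finite local Frobenius ring with residue field $\mathbb{F}_2$, and let $e$ be the unique element with $\mathrm{Ann}_R(e)=\mathfrak{m}$. Let $a\in R$ with $a\notin\{0,e\}$. The following are equivalent: (1) $Ra$ is a minimal element of the set of ideals of $R$ properly containing $Re$; (2) $xa\in Re$ for all $x\in\mathfrak{m}$; (3) $a\in\mathrm{Ann}_R(\mathfrak{m}^2)$; (4) $a\in\mathrm{soc}^2(R)$; (5) $|R/\mathrm{Ann}_R(a)|=4$.
   Context: All rings are finite, commutative with identity. A finite ring $R$ is Frobenius if for some positive integer $n$ with $nR=0$ there is a $\mathbb{Z}/n$-linear map $\psi\colon R\to\mathbb{Z}/n$ whose kernel contains no nonzero ideal. In this setting $Re=\{0,e\}$ is the unique minimal nonzero ideal of $R$. Define $\mathrm{soc}^1(R)=\{b\in R: xb=0\ \forall x\in\mathfrak{m}\}$ and $\mathrm{soc}^2(R)=\{b\in R: xb\in\mathrm{soc}^1(R)\ \forall x\in\mathfrak{m}\}$ (the preimage in $R$ of the socle of $R/\mathrm{soc}^1(R)$). -}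

module Defs where

open import Level using (Level; _⊔_; suc)
open import Algebra.Bundles using (CommutativeRing)
open import Data.Nat.Base using (ℕ; zero; suc)
open import Data.Sum using (_⊎_)
open import Data.Fin.Base using (Fin)
open import Data.Integer.Base as ℤ using (ℤ; +_)
open import Data.Integer.Divisibility using () renaming (_∣_ to _∣ℤ_)
open import Data.Product using (Σ; ∃; ∃-syntax; _×_; _,_)
open import Relation.Nullary using (¬_)
open import Relation.Binary.PropositionalEquality using (_≡_)

module RingDefs {c ℓ : Level} (R : CommutativeRing c ℓ) where
  open CommutativeRing R

  L : ∀ {a} → Set a → Set (c ⊔ ℓ ⊔ a)
  L {a} A = Level.Lift (c ⊔ ℓ) A

  Subset : Set (Level.suc (c ⊔ ℓ))
  Subset = Carrier → Set (c ⊔ ℓ)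

  _⊆_ : Subset → Subset → Set (c ⊔ ℓ)
  I ⊆ J = ∀ x → I x → J x

  _⊂_ : Subset → Subset → Set (c ⊔ ℓ)
  I ⊂ J = I ⊆ J × ∃[ x ] (J x × ¬ I x)

  record IsIdeal (I : Subset) : Set (c ⊔ ℓ) where
    field
      resp  : ∀ {x y} → x ≈ y → I x → I y
      zero∈ : I 0#
      +-closed : ∀ {x y} → I x → I y → I (x + y)
      *-closed : ∀ r {x} → I x → I (r * x)

  record IsMaximalIdeal (M : Subset) : Set (Level.suc (c ⊔ ℓ)) where
    field
      ideal  : IsIdeal M
      proper : ¬ M 1#
      maximal : ∀ (J : Subset) → IsIdeal J → M ⊆ J → (J ⊆ M) ⊎ (∀ x → J x)

  principal : Carrier → Subset
  principal a x = ∃[ r ] (x ≈ r * a)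

  Ann : Subset → Subset
  Ann S x = ∀ y → S y → y * x ≈ 0#

  AnnElt : Carrier → Subset
  AnnElt a x = L (x * a ≈ 0#)

  data Square (M : Subset) : Carrier → Set (c ⊔ ℓ) where
    sq-zero : ∀ {z} → z ≈ 0# → Square M z
    sq-prod : ∀ {x y z} → M x → M y → z ≈ x * y → Square M z
    sq-sum  : ∀ {u v z} → Square M u → Square M v → z ≈ u + v → Square M z

  soc¹ : Subset → Subset
  soc¹ M b = ∀ x → M x → x * b ≈ 0#

  soc² : Subset → Subset
  soc² M b = ∀ x → M x → soc¹ M (x * b)

  QuotientHasCard : Subset → ℕ → Set (c ⊔ ℓ)
  QuotientHasCard I k =
    Σ (Fin k → Carrier) λ rep →
      (∀ i j → I (rep i - rep j) → L (i ≡ j)) ×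
      (∀ x → ∃[ i ] I (x - rep i))

  Finite : Set (c ⊔ ℓ)
  Finite = Σ ℕ λ N → Σ (Carrier → Fin N) λ to → Σ (Fin N → Carrier) λ from →
             (∀ x → from (to x) ≈ x) × (∀ i → L (to (from i) ≡ i)) ×
             (∀ {x y} → x ≈ y → L (to x ≡ to y))

  IsLocalWith : Subset → Set (Level.suc (c ⊔ ℓ))
  IsLocalWith M = IsMaximalIdeal M ×
    (∀ (M' : Subset) → IsMaximalIdeal M' → (M' ⊆ M) × (M ⊆ M'))

  _·_ : ℕ → Carrier → Carrier
  zero  · x = 0#
  suc n · x = x + n · x

  -- Frobenius: for some n > 0 with nR = 0, there is a ℤ/n-linear map
  -- ψ : R → ℤ/n whose kernel contains no nonzero ideal.  ℤ/n is represented
  -- by ℤ modulo n: ψ is a function R → ℤ, well defined and additive mod n.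
  IsFrobenius : Set (Level.suc (c ⊔ ℓ))
  IsFrobenius = Σ ℕ λ n → (¬ n ≡ 0) × (∀ x → n · x ≈ 0#) ×
    Σ (Carrier → ℤ) λ ψ →
      (∀ {x y} → x ≈ y → L ((+ n) ∣ℤ (ψ x ℤ.- ψ y))) ×
      (∀ x y → L ((+ n) ∣ℤ (ψ (x + y) ℤ.- (ψ x ℤ.+ ψ y)))) ×
      (∀ (I : Subset) → IsIdeal I → (∀ x → I x → L ((+ n) ∣ℤ ψ x)) →
         ∀ x → I x → x ≈ 0#)

{-# OPTIONS --safe #-}
module Submission where

-- Maximality of m yields excluded middle, and finiteness yields a maximal ideal above every
-- proper ideal, so elements outside m are units. The Frobenius form pins down the socle: a
-- nonzero w with m w = 0 spans the ideal {0, w}, so ψ w is an element of order two of ℤ/n,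
-- and there is only one such; hence soc¹ = Re. Then (2) and (4) both say m a ⊆ Re, and (3)
-- is (4) read through m². If m a ⊆ Re, some t ∈ m has t a = e, and an ideal J strictly
-- between Re and Ra contains some r a ∉ Re; then r ∈ 1 + m, so a = r a - (r - 1) a ∈ J.
-- If x a ∉ Re for some x ∈ m, minimality puts a into Re + R x a, so (1 - s x) a ∈ Re for
-- some s, and 1 - s x is a unit. Finally R / Ann a ≅ R a, which is {0, e, a, a + e} under
-- (2) and otherwise contains the five distinct elements 0, x a, y x a, a, a + x a.

open import Defs
open import Level using (_⊔_; lift; lower)
open import Algebra.Bundles using (CommutativeRing)
open import Axiom.ExcludedMiddle using (ExcludedMiddle)
open import Data.Fin.Base using (Fin; zero; suc)
open import Data.Fin.Properties using (injective⇒≤)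
open import Data.Integer.Base as ℤ using (ℤ; +_)
open import Data.Integer.Divisibility using () renaming (_∣_ to _∣ᵤ_)
open import Data.Integer.Divisibility.Signed using (_∣_; ∣ᵤ⇒∣; ∣⇒∣ᵤ)
open import Data.List.Base using (List; []; _∷_; foldl; tabulate)
open import Data.List.Membership.Propositional using (_∈_)
open import Data.List.Membership.Propositional.Properties using (∈-tabulate⁺)
open import Data.List.Relation.Unary.Any using (here; there)
open import Data.Nat.Base as ℕ using (ℕ; _≤_)
open import Data.Nat.Properties using (1+n≰n)
open import Data.Product using (∃-syntax; _×_; _,_; proj₁; proj₂)
open import Data.Sum using (_⊎_; inj₁; inj₂; [_,_])
open import Data.Vec.Base using (Vec; []; _∷_; lookup)
open import Data.Vec.Relation.Unary.All using ([]; _∷_)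
open import Data.Vec.Relation.Unary.AllPairs using ([]; _∷_)
open import Function.Base using (_∘_; id)
open import Function.Bundles using (_⇔_; mk⇔)
open import Function.Construct.Composition using (_⇔-∘_)
open import Function.Construct.Symmetry using (⇔-sym)
open import Relation.Binary.Bundles using (Setoid)
open import Relation.Nullary using (¬_; Dec; yes; no; contradiction)
open import Relation.Nullary.Decidable using (map′; decidable-stable)
import Relation.Binary.PropositionalEquality as ≡
import Data.Vec.Relation.Unary.Unique.Setoid as UniqueSetoid
open import Data.Vec.Relation.Unary.Unique.Setoid.Properties using (lookup-injective)

module IntegerDivisibility where
  open import Data.Nat.Base as ℕ using (zero; suc)
  open import Data.Integer.Base using (+_; _+_; _-_; _*_)
  open import Data.Integer.Properties using (*-cancelˡ-≡; +-identityˡ)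
  open import Data.Integer.DivMod using (_/ℕ_; _%ℕ_; a≡a%ℕn+[a/ℕn]*n; n%ℕd<d)
  open import Data.Integer.Divisibility.Signed using (_∣_; divides; ∣m∣n⇒∣m+n; ∣m∣n⇒∣m-n)
  open import Data.Integer.Tactic.RingSolver using (solve-∀)
  open import Relation.Binary.PropositionalEquality
    using (_≡_; sym; trans; cong; cong₂; subst; module ≡-Reasoning)

  double-injective : ∀ {i j} → i + i ≡ j + j → i ≡ j
  double-injective {i} {j} eq = *-cancelˡ-≡ (+ 2) i j (trans (double i) (trans eq (sym (double j))))
    where
    double : ∀ i → + 2 * i ≡ i + i
    double = solve-∀

  ∣-double : ∀ {n i} → n ∣ i + i → n ∣ i ⊎ ∃[ q ] i + i ≡ (+ 1 + q * + 2) * n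
  ∣-double {n} {i} (divides k i+i≡k*n) with k %ℕ 2 | n%ℕd<d k 2 | a≡a%ℕn+[a/ℕn]*n k 2
  ... | 0 | _ | k≡q*2 = inj₁ (divides q (double-injective (begin
    i + i                  ≡⟨ i+i≡k*n ⟩
    k * n                  ≡⟨ cong (_* n) (trans k≡q*2 (+-identityˡ (q * + 2))) ⟩
    q * + 2 * n            ≡⟨ even q n ⟩
    q * n + q * n          ∎)))
    where
    open ≡-Reasoning
    q = k /ℕ 2
    even : ∀ q n → q * + 2 * n ≡ q * n + q * n
    even = solve-∀
  ... | 1 | _ | k≡1+q*2 = inj₂ (k /ℕ 2 , trans i+i≡k*n (cong (_* n) k≡1+q*2))
  ... | suc (suc _) | ℕ.s≤s (ℕ.s≤s ()) | _

  -- ℤ/n has at most one element of order two, and it is its own negative.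
  ∣-+-of-halves : ∀ {n i j} → n ∣ i + i → n ∣ j + j → ¬ n ∣ i → ¬ n ∣ j → n ∣ i + j
  ∣-+-of-halves {n} {i} {j} n∣2i n∣2j n∤i n∤j with ∣-double n∣2i | ∣-double n∣2j
  ... | inj₁ n∣i | _        = contradiction n∣i n∤i
  ... | _        | inj₁ n∣j = contradiction n∣j n∤j
  ... | inj₂ (q , 2i≡) | inj₂ (q′ , 2j≡) = divides (+ 1 + q + q′) (double-injective (begin
    (i + j) + (i + j)                          ≡⟨ interchange i j ⟩
    (i + i) + (j + j)                          ≡⟨ cong₂ _+_ 2i≡ 2j≡ ⟩
    (+ 1 + q * + 2) * n + (+ 1 + q′ * + 2) * n ≡⟨ odd-sum q q′ n ⟩
    (+ 1 + q + q′) * n + (+ 1 + q + q′) * n    ∎))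
    where
    open ≡-Reasoning
    interchange : ∀ i j → (i + j) + (i + j) ≡ (i + i) + (j + j)
    interchange = solve-∀
    odd-sum : ∀ q q′ n →
      (+ 1 + q * + 2) * n + (+ 1 + q′ * + 2) * n ≡ (+ 1 + q + q′) * n + (+ 1 + q + q′) * n
    odd-sum = solve-∀

  ∣i-j⇒∣j⇒∣i : ∀ {n i j} → n ∣ i - j → n ∣ j → n ∣ i
  ∣i-j⇒∣j⇒∣i {n} {i} {j} n∣i-j n∣j = subst (n ∣_) (cancel i j) (∣m∣n⇒∣m+n n∣i-j n∣j)
    where
    cancel : ∀ i j → i - j + j ≡ i
    cancel = solve-∀

  ∣i-j⇒∣i⇒∣j : ∀ {n i j} → n ∣ i - j → n ∣ i → n ∣ j
  ∣i-j⇒∣i⇒∣j {n} {i} {j} n∣i-j n∣i = subst (n ∣_) (cancel i j) (∣m∣n⇒∣m-n n∣i n∣i-j)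
    where
    cancel : ∀ i j → i - (i - j) ≡ j
    cancel = solve-∀

  ∣k-i⇒∣k-[i+i]⇒∣i : ∀ {n k i} → n ∣ k - i → n ∣ k - (i + i) → n ∣ i
  ∣k-i⇒∣k-[i+i]⇒∣i {n} {k} {i} n∣k-i n∣k-2i = ∣i-j⇒∣i⇒∣j (subst (n ∣_) (regroup k i) n∣k-2i) n∣k-i
    where
    regroup : ∀ k i → k - (i + i) ≡ (k - i) - i
    regroup = solve-∀

open IntegerDivisibility using (∣-+-of-halves; ∣i-j⇒∣j⇒∣i; ∣i-j⇒∣i⇒∣j; ∣k-i⇒∣k-[i+i]⇒∣i)

module CommutativeRingTheory {c ℓ} (R : CommutativeRing c ℓ) where
  open CommutativeRing R hiding (zero)
  open RingDefs R
  open import Algebra.Properties.Ring ring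
    using (-1*x≈-x; [y-z]x≈yx-zx; x[y-z]≈xy-xz; -0#≈0#; x∙y⁻¹≈ε⇒x≈y; x≈y⇒x∙y⁻¹≈ε;
           //-rightDividesˡ; //-rightDividesʳ; \\-leftDividesʳ; ⁻¹-anti-homo‿-; -‿+-comm; -‿involutive;
           +-identityˡ-unique; +-inverseˡ-unique)
  open import Algebra.Properties.CommutativeSemigroup +-commutativeSemigroup using (interchange)
  open import Algebra.Properties.CommutativeSemigroup *-commutativeSemigroup using (x∙yz≈y∙xz)
  open import Relation.Binary.Reasoning.Setoid setoid

  private
    variable
      x y z a b b′ r s s′ u w : Carrier
      I J S : Subset

    x-0*y≈x : x - 0# * y ≈ x
    x-0*y≈x {x} {y} = begin
      x - 0# * y  ≈⟨ +-congˡ (-‿cong (zeroˡ y)) ⟩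
      x - 0#      ≈⟨ +-congˡ -0#≈0# ⟩
      x + 0#      ≈⟨ +-identityʳ x ⟩
      x           ∎

    x-[x-y]≈y : ∀ x y → x - (x - y) ≈ y
    x-[x-y]≈y x y = begin
      x - (x - y)  ≈⟨ +-congˡ (⁻¹-anti-homo‿- x y) ⟩
      x + (y - x)  ≈⟨ +-assoc x y (- x) ⟨
      x + y - x    ≈⟨ +-congʳ (+-comm x y) ⟩
      y + x - x    ≈⟨ //-rightDividesʳ x y ⟩
      y            ∎

    [x-y]+[y-z]≈x-z : ∀ x y z → (x - y) + (y - z) ≈ x - z
    [x-y]+[y-z]≈x-z x y z = begin
      (x - y) + (y - z)  ≈⟨ +-assoc x (- y) (y - z) ⟩
      x + (- y + (y - z)) ≈⟨ +-congˡ (\\-leftDividesʳ y (- z)) ⟩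
      x - z              ∎

    [x-y]a≈0⇒xa≈ya : (x - y) * a ≈ 0# → x * a ≈ y * a
    [x-y]a≈0⇒xa≈ya {x} {y} {a} eq = x∙y⁻¹≈ε⇒x≈y (x * a) (y * a) (trans (sym ([y-z]x≈yx-zx a x y)) eq)

    xa≈ya⇒[x-y]a≈0 : x * a ≈ y * a → (x - y) * a ≈ 0#
    xa≈ya⇒[x-y]a≈0 {x} {a} {y} eq = trans ([y-z]x≈yx-zx a x y) (x≈y⇒x∙y⁻¹≈ε eq)

  module IdealProperties {I : Subset} (I-ideal : IsIdeal I) where
    open IsIdeal I-ideal public

    -‿closed : I x → I (- x)
    -‿closed {x} Ix = resp (-1*x≈-x x) (*-closed (- 1#) Ix)

    sub-closed : I x → I y → I (x - y)
    sub-closed Ix Iy = +-closed Ix (-‿closed Iy)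

    sub-cancelʳ : I (x - y) → I y → I x
    sub-cancelʳ {x} {y} Ix-y Iy = resp (//-rightDividesˡ y x) (+-closed Ix-y Iy)

    sub-cancelˡ : I x → I (x - y) → I y
    sub-cancelˡ {x} {y} Ix Ix-y = resp (x-[x-y]≈y x y) (sub-closed Ix Ix-y)

    sub-sym : I (x - y) → I (y - x)
    sub-sym {x} {y} Ix-y = resp (⁻¹-anti-homo‿- x y) (-‿closed Ix-y)

    sub-trans : I (x - y) → I (y - z) → I (x - z)
    sub-trans {x} {y} {z} Ix-y Iy-z = resp ([x-y]+[y-z]≈x-z x y z) (+-closed Ix-y Iy-z)

    1∈⇒full : I 1# → ∀ x → I x
    1∈⇒full I1 x = resp (*-identityʳ x) (*-closed x I1)

  a∈Ra : ∀ a → principal a a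
  a∈Ra a = 1# , sym (*-identityˡ a)

  principal-isIdeal : ∀ a → IsIdeal (principal a)
  principal-isIdeal a = record
    { resp     = λ { x≈y (r , x≈ra) → r , trans (sym x≈y) x≈ra }
    ; zero∈    = 0# , sym (zeroˡ a)
    ; +-closed = λ { {x} {y} (r , x≈ra) (s , y≈sa) → r + s , trans (+-cong x≈ra y≈sa) (sym (distribʳ a r s)) }
    ; *-closed = λ { t (r , x≈ra) → t * r , trans (*-congˡ x≈ra) (sym (*-assoc t r a)) }
    }

  principal-⊆ : IsIdeal I → I a → principal a ⊆ I
  principal-⊆ I-ideal Ia x (r , x≈ra) = resp (sym x≈ra) (*-closed r Ia)
    where open IsIdeal I-ideal

  Ann-isIdeal : ∀ S → IsIdeal (Ann S)
  Ann-isIdeal S = record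
    { resp     = λ x≈x′ yx≈0 y Sy → trans (*-congˡ (sym x≈x′)) (yx≈0 y Sy)
    ; zero∈    = λ y _ → zeroʳ y
    ; +-closed = λ {x} {x′} yx≈0 yx′≈0 y Sy → begin
        y * (x + x′)        ≈⟨ distribˡ y x x′ ⟩
        y * x + y * x′      ≈⟨ +-cong (yx≈0 y Sy) (yx′≈0 y Sy) ⟩
        0# + 0#             ≈⟨ +-identityʳ 0# ⟩
        0#                  ∎
    ; *-closed = λ r {x} yx≈0 y Sy → begin
        y * (r * x)         ≈⟨ x∙yz≈y∙xz y r x ⟩
        r * (y * x)         ≈⟨ *-congˡ (yx≈0 y Sy) ⟩
        r * 0#              ≈⟨ zeroʳ r ⟩
        0#                  ∎
    }

  AnnElt-isIdeal : ∀ a → IsIdeal (AnnElt a)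
  AnnElt-isIdeal a = record
    { resp     = λ { x≈y (lift xa≈0) → lift (trans (*-congʳ (sym x≈y)) xa≈0) }
    ; zero∈    = lift (zeroˡ a)
    ; +-closed = λ { {x} {y} (lift xa≈0) (lift ya≈0) →
                     lift (trans (distribʳ a x y) (trans (+-cong xa≈0 ya≈0) (+-identityʳ 0#))) }
    ; *-closed = λ { r {x} (lift xa≈0) → lift (trans (*-assoc r x a) (trans (*-congˡ xa≈0) (zeroʳ r))) }
    }

  Ann-Square⇔soc² : ∀ M a → Ann (Square M) a ⇔ soc² M a
  Ann-Square⇔soc² M a = mk⇔ (λ ann x Mx y My → trans (sym (*-assoc y x a)) (ann (y * x) (sq-prod My Mx refl)))
                             (λ soc z Mz → annihilates soc Mz)
    where
    annihilates : soc² M a → Square M z → z * a ≈ 0#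
    annihilates soc (sq-zero z≈0) = trans (*-congʳ z≈0) (zeroˡ a)
    annihilates soc (sq-prod {x} {y} Mx My z≈xy) = begin
      _ * a           ≈⟨ *-congʳ z≈xy ⟩
      x * y * a       ≈⟨ *-assoc x y a ⟩
      x * (y * a)     ≈⟨ soc y My x Mx ⟩
      0#              ∎
    annihilates soc (sq-sum {u} {v} Su Sv z≈u+v) = begin
      _ * a           ≈⟨ *-congʳ z≈u+v ⟩
      (u + v) * a     ≈⟨ distribʳ a u v ⟩
      u * a + v * a   ≈⟨ +-cong (annihilates soc Su) (annihilates soc Sv) ⟩
      0# + 0#         ≈⟨ +-identityʳ 0# ⟩
      0#              ∎

  infixl 25 _+⟨_⟩
  _+⟨_⟩ : Subset → Carrier → Subset
  (I +⟨ x ⟩) y = ∃[ r ] I (y - r * x)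

  module _ {I : Subset} (I-ideal : IsIdeal I) where
    open IdealProperties I-ideal

    +⟨⟩-isIdeal : ∀ x → IsIdeal (I +⟨ x ⟩)
    +⟨⟩-isIdeal x = record
      { resp     = λ { y≈y′ (r , I[y-rx]) → r , resp (+-congʳ y≈y′) I[y-rx] }
      ; zero∈    = 0# , resp (sym x-0*y≈x) zero∈
      ; +-closed = λ { {y} {z} (r , I[y-rx]) (s , I[z-sx]) →
                       r + s , resp (sum y z r s) (+-closed I[y-rx] I[z-sx]) }
      ; *-closed = λ { t {y} (r , I[y-rx]) → t * r , resp (scale t y r) (*-closed t I[y-rx]) }
      }
      where
      sum : ∀ y z r s → (y - r * x) + (z - s * x) ≈ (y + z) - (r + s) * x
      sum y z r s = begin
        (y - r * x) + (z - s * x)   ≈⟨ interchange y (- (r * x)) z (- (s * x)) ⟩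
        (y + z) + (- (r * x) - s * x) ≈⟨ +-congˡ (-‿+-comm (r * x) (s * x)) ⟩
        (y + z) - (r * x + s * x)   ≈⟨ +-congˡ (-‿cong (distribʳ x r s)) ⟨
        (y + z) - (r + s) * x       ∎
      scale : ∀ t y r → t * (y - r * x) ≈ t * y - t * r * x
      scale t y r = trans (x[y-z]≈xy-xz t y (r * x)) (+-congˡ (-‿cong (sym (*-assoc t r x))))

    ⊆-+⟨⟩ : ∀ x → I ⊆ I +⟨ x ⟩
    ⊆-+⟨⟩ x y Iy = 0# , resp (sym x-0*y≈x) Iy

    x∈+⟨x⟩ : ∀ x → (I +⟨ x ⟩) x
    x∈+⟨x⟩ x = 1# , resp (sym (trans (+-congˡ (-‿cong (*-identityˡ x))) (-‿inverseʳ x))) zero∈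

  +⟨⟩-least : IsIdeal J → I ⊆ J → J x → I +⟨ x ⟩ ⊆ J
  +⟨⟩-least J-ideal I⊆J Jx y (r , I[y-rx]) = sub-cancelʳ (I⊆J _ I[y-rx]) (*-closed r Jx)
    where open IdealProperties J-ideal

  +⟨⟩-mono : I ⊆ J → I +⟨ x ⟩ ⊆ J +⟨ x ⟩
  +⟨⟩-mono I⊆J y (r , I[y-rx]) = r , I⊆J _ I[y-rx]

  module Congruence {I : Subset} (I-ideal : IsIdeal I) where
    open IdealProperties I-ideal

    ≋-setoid : Setoid c (c ⊔ ℓ)
    ≋-setoid = record
      { Carrier       = Carrier
      ; _≈_           = λ x y → I (x - y)
      ; isEquivalence = record
        { refl  = λ {x} → resp (sym (-‿inverseʳ x)) zero∈
        ; sym   = sub-sym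
        ; trans = sub-trans
        }
      }

    open UniqueSetoid ≋-setoid using (Unique) public

    distinct≤classes : ∀ {k j} (rep : Fin k → Carrier) → (∀ x → ∃[ i ] I (x - rep i)) →
                       {xs : Vec Carrier j} → Unique xs → j ≤ k
    distinct≤classes rep cover {xs} xs-unique = injective⇒≤ class-injective
      where
      class : Fin _ → Fin _
      class i = proj₁ (cover (lookup xs i))
      class-injective : ∀ {i i′} → class i ≡.≡ class i′ → i ≡.≡ i′
      class-injective {i} {i′} eq = lookup-injective ≋-setoid xs-unique i i′
        (sub-trans (proj₂ (cover (lookup xs i)))
          (sub-sym (≡.subst (λ k → I (lookup xs i′ - rep k)) (≡.sym eq) (proj₂ (cover (lookup xs i′))))))

  -- M extended by an arbitrary proposition P is an ideal, so maximality of M decides P.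
  maximal⇒excludedMiddle : ∀ {M} → IsMaximalIdeal M → ExcludedMiddle (c ⊔ ℓ)
  maximal⇒excludedMiddle {M} M-maximal {P} with maximal (λ y → M y ⊎ P) M⊎P-isIdeal (λ _ → inj₁)
    where
    open IsMaximalIdeal M-maximal
    open IsIdeal ideal
    M⊎P-isIdeal : IsIdeal (λ y → M y ⊎ P)
    M⊎P-isIdeal = record
      { resp     = λ x≈y → [ inj₁ ∘ resp x≈y , inj₂ ]
      ; zero∈    = inj₁ zero∈
      ; +-closed = λ { (inj₁ Mx) (inj₁ My) → inj₁ (+-closed Mx My) ; (inj₂ p) _ → inj₂ p ; _ (inj₂ p) → inj₂ p }
      ; *-closed = λ r → [ inj₁ ∘ *-closed r , inj₂ ]
      }
  ... | inj₁ M⊎P⊆M = no (λ p → IsMaximalIdeal.proper M-maximal (M⊎P⊆M 1# (inj₂ p)))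
  ... | inj₂ M⊎P-full = [ (λ M1 → contradiction M1 (IsMaximalIdeal.proper M-maximal)) , yes ] (M⊎P-full 1#)

  module Classical (em : ExcludedMiddle (c ⊔ ℓ)) where

    infix 4 _≈?_
    _≈?_ : ∀ x y → Dec (x ≈ y)
    x ≈? y = map′ lower lift (em {L (x ≈ y)})

    ¬Ann⇒witness : ¬ Ann S b → ∃[ y ] S y × ¬ y * b ≈ 0#
    ¬Ann⇒witness {S} {b} ¬ann with em {∃[ y ] S y × ¬ y * b ≈ 0#}
    ... | yes witness = witness
    ... | no ∄witness = contradiction
          (λ y Sy → decidable-stable (y * b ≈? 0#) (λ yb≉0 → ∄witness (y , Sy , yb≉0))) ¬ann

    adjoinIfProper : Subset → Carrier → Subset
    adjoinIfProper I x with em {(I +⟨ x ⟩) 1#}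
    ... | yes _ = I
    ... | no  _ = I +⟨ x ⟩

    module _ {I : Subset} (I-ideal : IsIdeal I) (x : Carrier) where

      adjoinIfProper-isIdeal : IsIdeal (adjoinIfProper I x)
      adjoinIfProper-isIdeal with em {(I +⟨ x ⟩) 1#}
      ... | yes _ = I-ideal
      ... | no  _ = +⟨⟩-isIdeal I-ideal x

      ⊆-adjoinIfProper : I ⊆ adjoinIfProper I x
      ⊆-adjoinIfProper with em {(I +⟨ x ⟩) 1#}
      ... | yes _ = λ _ Iy → Iy
      ... | no  _ = ⊆-+⟨⟩ I-ideal x

      adjoinIfProper-proper : ¬ I 1# → ¬ adjoinIfProper I x 1#
      adjoinIfProper-proper 1∉I with em {(I +⟨ x ⟩) 1#}
      ... | yes _    = 1∉I
      ... | no  1∉I+ = 1∉I+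

      adjoinIfProper-saturated : adjoinIfProper I x x ⊎ (I +⟨ x ⟩) 1#
      adjoinIfProper-saturated with em {(I +⟨ x ⟩) 1#}
      ... | yes 1∈I+ = inj₂ 1∈I+
      ... | no  _    = inj₁ (x∈+⟨x⟩ I-ideal x)

    grow : Subset → List Carrier → Subset
    grow = foldl adjoinIfProper

    grow-isIdeal : IsIdeal I → ∀ xs → IsIdeal (grow I xs)
    grow-isIdeal I-ideal []       = I-ideal
    grow-isIdeal I-ideal (x ∷ xs) = grow-isIdeal (adjoinIfProper-isIdeal I-ideal x) xs

    ⊆-grow : IsIdeal I → ∀ xs → I ⊆ grow I xs
    ⊆-grow I-ideal []       y Iy = Iy
    ⊆-grow I-ideal (x ∷ xs) y Iy =
      ⊆-grow (adjoinIfProper-isIdeal I-ideal x) xs y (⊆-adjoinIfProper I-ideal x y Iy)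

    grow-proper : IsIdeal I → ¬ I 1# → ∀ xs → ¬ grow I xs 1#
    grow-proper I-ideal 1∉I []       = 1∉I
    grow-proper I-ideal 1∉I (x ∷ xs) =
      grow-proper (adjoinIfProper-isIdeal I-ideal x) (adjoinIfProper-proper I-ideal x 1∉I) xs

    grow-saturated : IsIdeal I → ∀ {x xs} → x ∈ xs → grow I xs x ⊎ (grow I xs +⟨ x ⟩) 1#
    grow-saturated {I} I-ideal {x} {_ ∷ xs} (here ≡.refl) with adjoinIfProper-saturated I-ideal x
    ... | inj₁ x∈I′  = inj₁ (⊆-grow (adjoinIfProper-isIdeal I-ideal x) xs x x∈I′)
    ... | inj₂ 1∈I+x = inj₂ (+⟨⟩-mono I⊆I′ 1# 1∈I+x)
      where
      I⊆I′ : I ⊆ grow I (x ∷ xs)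
      I⊆I′ y = ⊆-grow (adjoinIfProper-isIdeal I-ideal x) xs y ∘ ⊆-adjoinIfProper I-ideal x y
    grow-saturated I-ideal {xs = x′ ∷ _} (there x∈xs) =
      grow-saturated (adjoinIfProper-isIdeal I-ideal x′) x∈xs

    -- Adjoining the elements of R one at a time while staying proper ends in a maximal ideal.
    ⊆-maximalIdeal : Finite → IsIdeal I → ¬ I 1# → ∃[ M ] IsMaximalIdeal M × I ⊆ M
    ⊆-maximalIdeal {I} (_ , to , from , from∘to , _) I-ideal 1∉I = M , M-maximal , ⊆-grow I-ideal elements
      where
      elements : List Carrier
      elements = tabulate from
      M : Subset
      M = grow I elements
      M-ideal : IsIdeal M
      M-ideal = grow-isIdeal I-ideal elements
      maximal : ∀ J → IsIdeal J → M ⊆ J → (J ⊆ M) ⊎ (∀ x → J x)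
      maximal J J-ideal M⊆J with em {J 1#}
      ... | yes 1∈J = inj₂ (IdealProperties.1∈⇒full J-ideal 1∈J)
      ... | no  1∉J = inj₁ J⊆M
        where
        open IsIdeal J-ideal using () renaming (resp to J-resp)
        J⊆M : J ⊆ M
        J⊆M y Jy with grow-saturated I-ideal (∈-tabulate⁺ {f = from} (to y))
        ... | inj₁ M[y′]  = IsIdeal.resp M-ideal (from∘to y) M[y′]
        ... | inj₂ 1∈M+y′ = contradiction (+⟨⟩-least J-ideal M⊆J (J-resp (sym (from∘to y)) Jy) 1# 1∈M+y′) 1∉J
      M-maximal : IsMaximalIdeal M
      M-maximal = record { ideal = M-ideal ; proper = grow-proper I-ideal 1∉I elements ; maximal = maximal }

    ∉local⇒invertible : ∀ {M u} → Finite → IsLocalWith M → ¬ M u → ∃[ r ] r * u ≈ 1#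
    ∉local⇒invertible {u = u} finite (_ , unique) u∉M with em {principal u 1#}
    ... | yes (r , 1≈ru) = r , sym 1≈ru
    ... | no  1∉Ru       =
      let M′ , M′-maximal , Ru⊆M′ = ⊆-maximalIdeal finite (principal-isIdeal u) 1∉Ru
      in  contradiction (proj₁ (unique M′ M′-maximal) u (Ru⊆M′ u (a∈Ra u))) u∉M

    card₂⇒residue : IsIdeal I → ¬ I 1# → QuotientHasCard I 2 → ∀ x → I x ⊎ I (x - 1#)
    card₂⇒residue {I} I-ideal 1∉I (rep , _ , cover) x with em {I x} | em {I (x - 1#)}
    ... | yes Ix | _          = inj₁ Ix
    ... | no  _  | yes Ix-1   = inj₂ Ix-1
    ... | no  x∉I | no x-1∉I  = contradiction (distinct≤classes rep cover 0,1,x-distinct) 1+n≰n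
      where
      open IdealProperties I-ideal
      open Congruence I-ideal using (Unique; distinct≤classes)
      0-y∈⇒y∈ : ∀ {y} → I (0# - y) → I y
      0-y∈⇒y∈ {y} I[0-y] = resp (-‿involutive y) (-‿closed (resp (+-identityˡ (- y)) I[0-y]))
      0,1,x-distinct : Unique (0# ∷ 1# ∷ x ∷ [])
      0,1,x-distinct = (1∉I ∘ 0-y∈⇒y∈ ∷ x∉I ∘ 0-y∈⇒y∈ ∷ []) ∷ (x-1∉I ∘ sub-sym ∷ []) ∷ [] ∷ []

  module AdditiveModulo (n : ℕ) (ψ : Carrier → ℤ)
    (ψ-cong : ∀ {x y} → x ≈ y → L (+ n ∣ᵤ ψ x ℤ.- ψ y))
    (ψ-+ : ∀ x y → L (+ n ∣ᵤ ψ (x + y) ℤ.- (ψ x ℤ.+ ψ y))) where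

    private
      ∣ψ-cong : x ≈ y → + n ∣ ψ x ℤ.- ψ y
      ∣ψ-cong {x} {y} x≈y = ∣ᵤ⇒∣ {+ n} {ψ x ℤ.- ψ y} (lower (ψ-cong x≈y))

      ∣ψ-+ : ∀ x y → + n ∣ ψ (x + y) ℤ.- (ψ x ℤ.+ ψ y)
      ∣ψ-+ x y = ∣ᵤ⇒∣ {+ n} {ψ (x + y) ℤ.- (ψ x ℤ.+ ψ y)} (lower (ψ-+ x y))

    ∣ψ-resp : x ≈ y → + n ∣ ψ y → + n ∣ ψ x
    ∣ψ-resp x≈y = ∣i-j⇒∣j⇒∣i (∣ψ-cong x≈y)

    ∣ψ+ψ⇒∣ψ[+] : + n ∣ ψ x ℤ.+ ψ y → + n ∣ ψ (x + y)
    ∣ψ+ψ⇒∣ψ[+] {x} {y} = ∣i-j⇒∣j⇒∣i (∣ψ-+ x y)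

    ∣ψ[+]⇒∣ψ+ψ : + n ∣ ψ (x + y) → + n ∣ ψ x ℤ.+ ψ y
    ∣ψ[+]⇒∣ψ+ψ {x} {y} = ∣i-j⇒∣i⇒∣j (∣ψ-+ x y)

    ∣ψ≈0 : x ≈ 0# → + n ∣ ψ x
    ∣ψ≈0 x≈0 = ∣ψ-resp x≈0 (∣k-i⇒∣k-[i+i]⇒∣i {k = ψ (0# + 0#)} (∣ψ-cong (+-identityʳ 0#)) (∣ψ-+ 0# 0#))

  IsMinimalAbove : Subset → Subset → Set (Level.suc (c ⊔ ℓ))
  IsMinimalAbove I K = I ⊂ K × (∀ J → IsIdeal J → I ⊂ J → J ⊆ K → K ⊆ J)

  module FiniteLocalF2 (finite : Finite) {m : Subset} (m-local : IsLocalWith m)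
                       (m-card₂ : QuotientHasCard m 2) where
    open IsMaximalIdeal (proj₁ m-local) using () renaming (ideal to m-ideal; proper to 1∉m)
    module m = IdealProperties m-ideal

    em : ExcludedMiddle (c ⊔ ℓ)
    em = maximal⇒excludedMiddle (proj₁ m-local)

    open Classical em public

    residue : ∀ x → m x ⊎ m (x - 1#)
    residue = card₂⇒residue m-ideal 1∉m m-card₂

    m[s+1-1] : m s → m ((s + 1#) - 1#)
    m[s+1-1] {s} = m.resp (sym (//-rightDividesʳ 1# s))

    m[1-1] : m (1# - 1#)
    m[1-1] = m.resp (sym (-‿inverseʳ 1#)) m.zero∈

    cosets-apart : m s → m (s′ - 1#) → ¬ m (s - s′)
    cosets-apart ms ms′-1 ms-s′ = 1∉m (m.sub-cancelˡ (m.sub-cancelˡ ms ms-s′) ms′-1)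

    1-m∉m : m w → ¬ m (1# - w)
    1-m∉m mw m1-w = 1∉m (m.sub-cancelʳ m1-w mw)

    ∉m⇒cancellable : ¬ m u → ∃[ r ] ∀ b → b ≈ r * (u * b)
    ∉m⇒cancellable {u} u∉m with ∉local⇒invertible finite m-local u∉m
    ... | r , ru≈1 = r , λ b → begin
      b             ≈⟨ *-identityˡ b ⟨
      1# * b        ≈⟨ *-congʳ ru≈1 ⟨
      r * u * b     ≈⟨ *-assoc r u b ⟩
      r * (u * b)   ∎

    ∉m-cancel : IsIdeal I → ¬ m u → I (u * b) → I b
    ∉m-cancel I-ideal u∉m I[ub] with ∉m⇒cancellable u∉m
    ... | r , b≈r[ub] = IsIdeal.resp I-ideal (sym (b≈r[ub] _)) (IsIdeal.*-closed I-ideal r I[ub])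

    ∉m-nonZeroDivisor : ¬ m u → u * b ≈ 0# → b ≈ 0#
    ∉m-nonZeroDivisor u∉m ub≈0 with ∉m⇒cancellable u∉m
    ... | r , b≈r[ub] = trans (b≈r[ub] _) (trans (*-congˡ ub≈0) (zeroʳ r))

    fixed-by-m⇒0 : m w → b ≈ w * b → b ≈ 0#
    fixed-by-m⇒0 {w} {b} mw b≈wb = ∉m-nonZeroDivisor (1-m∉m mw) (begin
      (1# - w) * b    ≈⟨ [y-z]x≈yx-zx b 1# w ⟩
      1# * b - w * b  ≈⟨ +-cong (*-identityˡ b) (-‿cong (sym b≈wb)) ⟩
      b - b           ≈⟨ -‿inverseʳ b ⟩
      0#              ∎)

    cosets-incongruent : ¬ a ≈ 0# → m s → m (s′ - 1#) → ¬ AnnElt a (s - s′)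
    cosets-incongruent a≉0 ms ms′-1 (lift [s-s′]a≈0) =
      a≉0 (∉m-nonZeroDivisor (cosets-apart ms ms′-1) [s-s′]a≈0)

    soc¹-scalar : soc¹ m b → ∀ r → r * b ≈ 0# ⊎ r * b ≈ b
    soc¹-scalar {b} b∈soc r with residue r
    ... | inj₁ mr   = inj₁ (b∈soc r mr)
    ... | inj₂ mr-1 = inj₂ (trans ([x-y]a≈0⇒xa≈ya (b∈soc _ mr-1)) (*-identityˡ b))

    principal-soc¹ : soc¹ m b → principal b y → y ≈ 0# ⊎ y ≈ b
    principal-soc¹ b∈soc (r , y≈rb) with soc¹-scalar b∈soc r
    ... | inj₁ rb≈0 = inj₁ (trans y≈rb rb≈0)
    ... | inj₂ rb≈b = inj₂ (trans y≈rb rb≈b)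

    soc¹-double : soc¹ m b → b + b ≈ 0#
    soc¹-double {b} b∈soc with residue (1# + 1#)
    ... | inj₁ m2     = begin
      b + b             ≈⟨ +-cong (*-identityˡ b) (*-identityˡ b) ⟨
      1# * b + 1# * b   ≈⟨ distribʳ b 1# 1# ⟨
      (1# + 1#) * b     ≈⟨ b∈soc _ m2 ⟩
      0#                ∎
    ... | inj₂ m[2-1] = contradiction (m.resp (//-rightDividesʳ 1# 1#) m[2-1]) 1∉m

    -- ψ b and ψ b′ are elements of order two of ℤ/n, so ψ (b + b′) ≡ 0; nondegeneracy of ψ
    -- on the socle element b + b′ then gives b ≈ - b′ ≈ b′.
    soc¹-nonzero-unique : IsFrobenius → soc¹ m b → soc¹ m b′ → ¬ b ≈ 0# → ¬ b′ ≈ 0# → b ≈ b′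
    soc¹-nonzero-unique {b} {b′} (n , _ , _ , ψ , ψ-cong , ψ-+ , ψ-nondegenerate) b∈soc b′∈soc b≉0 b′≉0
      with b ≈? b′
    ... | yes b≈b′ = b≈b′
    ... | no  b≉b′ = contradiction
          (soc¹-∣ψ⇒≈0 (IsIdeal.+-closed (Ann-isIdeal m) b∈soc b′∈soc)
            (∣ψ+ψ⇒∣ψ[+] (∣-+-of-halves (∣ψ-double b∈soc) (∣ψ-double b′∈soc)
                           (b≉0 ∘ soc¹-∣ψ⇒≈0 b∈soc) (b′≉0 ∘ soc¹-∣ψ⇒≈0 b′∈soc))))
          b+b′≉0
      where
      open AdditiveModulo n ψ ψ-cong ψ-+

      ∣ψ-double : soc¹ m w → + n ∣ ψ w ℤ.+ ψ w
      ∣ψ-double w∈soc = ∣ψ[+]⇒∣ψ+ψ (∣ψ≈0 (soc¹-double w∈soc))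

      soc¹-∣ψ⇒≈0 : soc¹ m w → + n ∣ ψ w → w ≈ 0#
      soc¹-∣ψ⇒≈0 {w} w∈soc n∣ψw = ψ-nondegenerate (principal w) (principal-isIdeal w) Rw⊆ker w (a∈Ra w)
        where
        Rw⊆ker : ∀ y → principal w y → L (+ n ∣ᵤ ψ y)
        Rw⊆ker y y∈Rw =
          lift (∣⇒∣ᵤ {+ n} {ψ y} ([ ∣ψ≈0 , (λ y≈w → ∣ψ-resp y≈w n∣ψw) ] (principal-soc¹ w∈soc y∈Rw)))

      b+b′≉0 : ¬ b + b′ ≈ 0#
      b+b′≉0 b+b′≈0 =
        b≉b′ (trans (+-inverseˡ-unique b b′ b+b′≈0) (sym (+-inverseˡ-unique b′ b′ (soc¹-double b′∈soc))))

    module Socle (frobenius : IsFrobenius) (e : Carrier)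
                 (Ann[e]≡m : ∀ x → (AnnElt e x → m x) × (m x → AnnElt e x)) where
      module Re = IsIdeal (principal-isIdeal e)

      e∈soc¹ : soc¹ m e
      e∈soc¹ x mx = lower (proj₂ (Ann[e]≡m x) mx)

      e≉0 : ¬ e ≈ 0#
      e≉0 e≈0 = 1∉m (proj₁ (Ann[e]≡m 1#) (lift (trans (*-identityˡ e) e≈0)))

      Re-cases : principal e y → y ≈ 0# ⊎ y ≈ e
      Re-cases = principal-soc¹ e∈soc¹

      Re⊆soc¹ : principal e ⊆ soc¹ m
      Re⊆soc¹ = principal-⊆ (Ann-isIdeal m) e∈soc¹

      soc¹⊆Re : soc¹ m ⊆ principal e
      soc¹⊆Re b b∈soc with b ≈? 0#
      ... | yes b≈0 = Re.resp (sym b≈0) Re.zero∈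
      ... | no  b≉0 = Re.resp (sym (soc¹-nonzero-unique frobenius b∈soc e∈soc¹ b≉0 e≉0)) (a∈Ra e)

      ∉Re : ¬ a ≈ 0# → ¬ a ≈ e → ¬ principal e a
      ∉Re a≉0 a≉e = [ a≉0 , a≉e ] ∘ Re-cases

      m·a⊆Re⇔soc² : ∀ a → (∀ x → m x → principal e (x * a)) ⇔ soc² m a
      m·a⊆Re⇔soc² a = mk⇔ (λ m·a⊆Re x mx → Re⊆soc¹ _ (m·a⊆Re x mx)) (λ soc x mx → soc¹⊆Re _ (soc x mx))

      module _ {a : Carrier} (a∉Re : ¬ principal e a) where
        private
          a≉0 : ¬ a ≈ 0#
          a≉0 a≈0 = a∉Re (Re.resp (sym a≈0) Re.zero∈)

          ≋⇒xa≈ya : AnnElt a (x - y) → x * a ≈ y * a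
          ≋⇒xa≈ya = [x-y]a≈0⇒xa≈ya ∘ lower

          0≋s⇒sa≈0 : AnnElt a (0# - s) → s * a ≈ 0#
          0≋s⇒sa≈0 0≋s = trans (sym (≋⇒xa≈ya 0≋s)) (zeroˡ a)

          1≋s+1⇒sa≈0 : AnnElt a (1# - (s + 1#)) → s * a ≈ 0#
          1≋s+1⇒sa≈0 {s} 1≋s+1 =
            +-identityˡ-unique (s * a) (1# * a) (trans (sym (distribʳ a s 1#)) (sym (≋⇒xa≈ya 1≋s+1)))

          [x-1]a≈sa⇒xa≈[s+1]a : (x - 1#) * a ≈ s * a → x * a ≈ (s + 1#) * a
          [x-1]a≈sa⇒xa≈[s+1]a {x} {s} [x-1]a≈sa = begin
            x * a                   ≈⟨ *-congʳ (//-rightDividesˡ 1# x) ⟨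
            ((x - 1#) + 1#) * a     ≈⟨ distribʳ a (x - 1#) 1# ⟩
            (x - 1#) * a + 1# * a   ≈⟨ +-congʳ [x-1]a≈sa ⟩
            s * a + 1# * a          ≈⟨ distribʳ a s 1# ⟨
            (s + 1#) * a            ∎

        e∈m·a : (∀ x → m x → principal e (x * a)) → ∃[ t ] m t × t * a ≈ e
        e∈m·a m·a⊆Re with ¬Ann⇒witness (a∉Re ∘ soc¹⊆Re a)
        ... | t , mt , ta≉0 = t , mt , [ (λ ta≈0 → contradiction ta≈0 ta≉0) , id ] (Re-cases (m·a⊆Re t mt))

        m·a⊆Re⇒minimal : (∀ x → m x → principal e (x * a)) → IsMinimalAbove (principal e) (principal a)
        m·a⊆Re⇒minimal m·a⊆Re = (Re⊆Ra , a , a∈Ra a , a∉Re) , minimality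
          where
          Re⊆Ra : principal e ⊆ principal a
          Re⊆Ra with e∈m·a m·a⊆Re
          ... | t , _ , ta≈e = principal-⊆ (principal-isIdeal a) (t , sym ta≈e)

          minimality : ∀ J → IsIdeal J → principal e ⊂ J → J ⊆ principal a → principal a ⊆ J
          minimality J J-ideal (Re⊆J , y , Jy , y∉Re) J⊆Ra = principal-⊆ J-ideal a∈J
            where
            open IdealProperties J-ideal
            a∈J : J a
            a∈J with J⊆Ra y Jy
            ... | r , y≈ra with residue r
            ...   | inj₁ mr   = contradiction (Re.resp (sym y≈ra) (m·a⊆Re r mr)) y∉Re
            ...   | inj₂ mr-1 = resp (*-identityˡ a)
                (sub-cancelˡ (resp y≈ra Jy) (resp ([y-z]x≈yx-zx a r 1#) (Re⊆J _ (m·a⊆Re _ mr-1))))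

        minimal⇒m·a⊆Re : IsMinimalAbove (principal e) (principal a) → ∀ x → m x → principal e (x * a)
        minimal⇒m·a⊆Re ((Re⊆Ra , _) , minimality) x mx with em {principal e (x * a)}
        ... | yes xa∈Re = xa∈Re
        ... | no  xa∉Re = contradiction a∈Re a∉Re
          where
          Re-ideal : IsIdeal (principal e)
          Re-ideal = principal-isIdeal e
          a∈Re+R[xa] : (principal e +⟨ x * a ⟩) a
          a∈Re+R[xa] = minimality (principal e +⟨ x * a ⟩) (+⟨⟩-isIdeal Re-ideal (x * a))
            (⊆-+⟨⟩ Re-ideal (x * a) , x * a , x∈+⟨x⟩ Re-ideal (x * a) , xa∉Re)
            (+⟨⟩-least (principal-isIdeal a) Re⊆Ra (x , refl)) a (a∈Ra a)
          [1-sx]a≈a-s[xa] : ∀ s → (1# - s * x) * a ≈ a - s * (x * a)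
          [1-sx]a≈a-s[xa] s =
            trans ([y-z]x≈yx-zx a 1# (s * x)) (+-cong (*-identityˡ a) (-‿cong (*-assoc s x a)))
          a∈Re : principal e a
          a∈Re with a∈Re+R[xa]
          ... | s , a-s[xa]∈Re =
            ∉m-cancel Re-ideal (1-m∉m (m.*-closed s mx)) (Re.resp (sym ([1-sx]a≈a-s[xa] s)) a-s[xa]∈Re)

        minimal⇔m·a⊆Re : IsMinimalAbove (principal e) (principal a) ⇔ (∀ x → m x → principal e (x * a))
        minimal⇔m·a⊆Re = mk⇔ minimal⇒m·a⊆Re m·a⊆Re⇒minimal

        open Congruence (AnnElt-isIdeal a) using (≋-setoid; Unique; distinct≤classes)

        m·a⊆Re⇒card₄ : (∀ x → m x → principal e (x * a)) → QuotientHasCard (AnnElt a) 4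
        m·a⊆Re⇒card₄ m·a⊆Re with e∈m·a m·a⊆Re
        ... | t , mt , ta≈e =
          lookup reps , (λ i j → lift ∘ lookup-injective ≋-setoid reps-distinct i j) , cover
          where
          reps : Vec Carrier 4
          reps = 0# ∷ t ∷ 1# ∷ t + 1# ∷ []

          ta≉0 : ¬ t * a ≈ 0#
          ta≉0 ta≈0 = e≉0 (trans (sym ta≈e) ta≈0)

          apart : m s → m (s′ - 1#) → ¬ AnnElt a (s - s′)
          apart = cosets-incongruent a≉0

          reps-distinct : Unique reps
          reps-distinct =
              (ta≉0 ∘ 0≋s⇒sa≈0 ∷ apart m.zero∈ m[1-1] ∷ apart m.zero∈ (m[s+1-1] mt) ∷ [])
            ∷ (apart mt m[1-1] ∷ apart mt (m[s+1-1] mt) ∷ [])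
            ∷ (ta≉0 ∘ 1≋s+1⇒sa≈0 ∷ [])
            ∷ [] ∷ []

          cover : ∀ x → ∃[ i ] AnnElt a (x - lookup reps i)
          cover x with residue x
          ... | inj₁ mx with Re-cases (m·a⊆Re x mx)
          ...   | inj₁ xa≈0 = zero , lift (xa≈ya⇒[x-y]a≈0 (trans xa≈0 (sym (zeroˡ a))))
          ...   | inj₂ xa≈e = suc zero , lift (xa≈ya⇒[x-y]a≈0 (trans xa≈e (sym ta≈e)))
          cover x | inj₂ mx-1 with Re-cases (m·a⊆Re _ mx-1)
          ...   | inj₁ [x-1]a≈0 = suc (suc zero) , lift [x-1]a≈0
          ...   | inj₂ [x-1]a≈e = suc (suc (suc zero)) ,
                    lift (xa≈ya⇒[x-y]a≈0 ([x-1]a≈sa⇒xa≈[s+1]a (trans [x-1]a≈e (sym ta≈e))))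

        card₄⇒m·a⊆Re : QuotientHasCard (AnnElt a) 4 → ∀ x → m x → principal e (x * a)
        card₄⇒m·a⊆Re (rep , _ , cover) x mx with em {principal e (x * a)}
        ... | yes xa∈Re = xa∈Re
        ... | no  xa∉Re with ¬Ann⇒witness (xa∉Re ∘ soc¹⊆Re _)
        ...   | y , my , y[xa]≉0 = contradiction (distinct≤classes rep cover five-distinct) 1+n≰n
          where
          xa≉0 : ¬ x * a ≈ 0#
          xa≉0 xa≈0 = xa∉Re (Re.resp (sym xa≈0) Re.zero∈)

          apart : m s → m (s′ - 1#) → ¬ AnnElt a (s - s′)
          apart = cosets-incongruent a≉0

          myx : m (y * x)
          myx = m.*-closed y mx

          five-distinct : Unique (0# ∷ x ∷ y * x ∷ 1# ∷ x + 1# ∷ [])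
          five-distinct =
              ( xa≉0 ∘ 0≋s⇒sa≈0
              ∷ (λ 0≋yx → y[xa]≉0 (trans (sym (*-assoc y x a)) (0≋s⇒sa≈0 0≋yx)))
              ∷ apart m.zero∈ m[1-1] ∷ apart m.zero∈ (m[s+1-1] mx) ∷ [])
            ∷ ( (λ x≋yx → xa≉0 (fixed-by-m⇒0 my (trans (≋⇒xa≈ya x≋yx) (*-assoc y x a))))
              ∷ apart mx m[1-1] ∷ apart mx (m[s+1-1] mx) ∷ [])
            ∷ (apart myx m[1-1] ∷ apart myx (m[s+1-1] mx) ∷ [])
            ∷ (xa≉0 ∘ 1≋s+1⇒sa≈0 ∷ [])
            ∷ [] ∷ []

        m·a⊆Re⇔card₄ : (∀ x → m x → principal e (x * a)) ⇔ QuotientHasCard (AnnElt a) 4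
        m·a⊆Re⇔card₄ = mk⇔ m·a⊆Re⇒card₄ card₄⇒m·a⊆Re

lemma4p5 : ∀ {c ℓ} (R : CommutativeRing c ℓ) →
    let open CommutativeRing R
        open RingDefs R
    in Finite →
       (m : Subset) → IsLocalWith m → QuotientHasCard m 2 →
       IsFrobenius →
       (e : Carrier) → (∀ x → (AnnElt e x → m x) × (m x → AnnElt e x)) →
       (a : Carrier) → ¬ a ≈ 0# → ¬ a ≈ e →
       let cond1 = (principal e ⊂ principal a) ×
                   (∀ (J : Subset) → IsIdeal J → principal e ⊂ J → J ⊆ principal a →
                      principal a ⊆ J)
           cond2 = ∀ x → m x → principal e (x * a)
           cond3 = Ann (Square m) a
           cond4 = soc² m a
           cond5 = QuotientHasCard (AnnElt a) 4
       in (cond1 ⇔ cond2) × (cond1 ⇔ cond3) × (cond1 ⇔ cond4) × (cond1 ⇔ cond5)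
lemma4p5 R finite m m-local m-card₂ frobenius e Ann[e]≡m a a≉0 a≉e =
  1⇔2 , ⇔-sym (Ann-Square⇔soc² m a) ⇔-∘ 1⇔4 , 1⇔4 , m·a⊆Re⇔card₄ a∉Re ⇔-∘ 1⇔2
  where
  open CommutativeRing R using (_*_)
  open RingDefs R
  open CommutativeRingTheory R
  open FiniteLocalF2 finite m-local m-card₂
  open Socle frobenius e Ann[e]≡m

  a∉Re : ¬ principal e a
  a∉Re = ∉Re a≉0 a≉e

  1⇔2 : IsMinimalAbove (principal e) (principal a) ⇔ (∀ x → m x → principal e (x * a))
  1⇔2 = minimal⇔m·a⊆Re a∉Re

  1⇔4 : IsMinimalAbove (principal e) (principal a) ⇔ soc² m a
  1⇔4 = m·a⊆Re⇔soc² a ⇔-∘ 1⇔2
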